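{- Let $n\ge3$ and let $\mathcal H_n$ be the directed $n\times n$ grid. Let $u\in V^-$ and let $w\in S(u)$ with $w\neq u$. Then there is a directed path in $\mathcal H_n$ from a node of $S$ to $u$ that does not contain $w$.
   Context: $\mathcal H_n$ is the directed graph with vertex set $V=[n]^2$ and an edge from $(x_1,x_2)$ to $(y_1,y_2)$ iff for some $i\in\{1,2\}$, $y_i-x_i=1$ and the other coordinate agrees. Let $\mathfrak m=\{(x_1,x_2): x_1=1\text{ or }x_2=1\}$, $V^-=V\setminus\{(1,n),(n,1)\}$ and $S=\mathfrak m\setminus\{(1,n),(n,1)\}$. For $u\in V$, $S(u)=\{v\in V^-: \text{there is a directed path from } v \text{ to } u\}$ (paths may consist of a single node, so $u\in S(u)$ when $u\in V^-$). -}

module Defs where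

open import Data.Nat using (ℕ; suc; _≤_)
open import Data.Product using (_×_; _,_; ∃)
open import Data.Sum using (_⊎_)
open import Data.List using (List; []; _∷_)
open import Relation.Binary.PropositionalEquality using (_≡_)
open import Relation.Nullary using (¬_)

-- A node (x₁ , x₂) of the grid; coordinates are 1-based as in the paper.
Node : Set
Node = ℕ × ℕ

InV : ℕ → Node → Set
InV n (x₁ , x₂) = (1 ≤ x₁ × x₁ ≤ n) × (1 ≤ x₂ × x₂ ≤ n)

Edge : ℕ → Node → Node → Set
Edge n x@(x₁ , x₂) y@(y₁ , y₂) =
  InV n x × InV n y × ((y₁ ≡ suc x₁ × y₂ ≡ x₂) ⊎ (y₂ ≡ suc x₂ × y₁ ≡ x₁))

data Path (n : ℕ) : Node → Node → Set where
  single : ∀ {v} → InV n v → Path n v v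
  step   : ∀ {v v' u} → Edge n v v' → Path n v' u → Path n v u

nodes : ∀ {n v u} → Path n v u → List Node
nodes (single {v} _) = v ∷ []
nodes (step {v} _ p) = v ∷ nodes p

data _∈_ (w : Node) : List Node → Set where
  here  : ∀ {xs} → w ∈ (w ∷ xs)
  there : ∀ {x xs} → w ∈ xs → w ∈ (x ∷ xs)

InV⁻ : ℕ → Node → Set
InV⁻ n v = InV n v × ¬ (v ≡ (1 , n)) × ¬ (v ≡ (n , 1))

Inm : ℕ → Node → Set
Inm n v@(x₁ , x₂) = InV n v × (x₁ ≡ 1 ⊎ x₂ ≡ 1)

InS : ℕ → Node → Set
InS n v = Inm n v × ¬ (v ≡ (1 , n)) × ¬ (v ≡ (n , 1))

InSof : ℕ → Node → Node → Set
InSof n u v = InV⁻ n v × Path n v u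

module Submission where

-- Write u = (a , b) and w = (c , d).  If a = 1 or b = 1 then u itself
-- lies in S and the one-node path at u avoids w, since w ≠ u.  Otherwise
-- a, b ≥ 2 and there are two cases.
--   * c = a: climb column a - 1 from (a - 1 , 1) ∈ S to (a - 1 , b) and take
--     the final edge to u.  All nodes but u lie in column a - 1 ≠ c.
--   * c ≠ a: pick a row k ∈ {1, 2} with k ≠ d (k ≠ n as n ≥ 3), walk along
--     row k from (1 , k) ∈ S to (a , k) and then up column a to u.  The nodes
--     of the first leg lie in row k ≠ d, those of the second in column a ≠ c.

open import Defs
open import Data.Nat using (ℕ; zero; suc; _≤_; _<_; _≤′_; _≟_; z≤n; s≤s)
open import Data.Nat.Properties
  using (≤-trans; ≤-refl; ≤∧≢⇒<; <⇒≤; m≤n⇒m≤1+n; n≤1+n; ≤⇒≤′; ≤′⇒≤; <⇒≢)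
open import Data.Product using (Σ; _×_; _,_; proj₁; proj₂)
open import Data.Sum using (_⊎_; inj₁; inj₂; [_,_])
open import Relation.Binary.PropositionalEquality using (_≡_; refl; sym; trans; cong)
open import Relation.Nullary using (¬_; yes; no)

Adjacent : Node → Node → Set
Adjacent (x₁ , x₂) (y₁ , y₂) = (y₁ ≡ suc x₁ × y₂ ≡ x₂) ⊎ (y₂ ≡ suc x₂ × y₁ ≡ x₁)

AvoidingPath : ℕ → Node → Node → Set
AvoidingPath n v u = Σ Node (λ s → InS n s × Σ (Path n s u) (λ p → ¬ (v ∈ nodes p)))

_++ᴾ_ : ∀ {n v m u} → Path n v m → Path n m u → Path n v u
single _ ++ᴾ q = q
step e p ++ᴾ q = step e (p ++ᴾ q)

∈-++ᴾ : ∀ {n v m u w} (p : Path n v m) (q : Path n m u) →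
        w ∈ nodes (p ++ᴾ q) → w ∈ nodes p ⊎ w ∈ nodes q
∈-++ᴾ (single _) q h         = inj₂ h
∈-++ᴾ (step e p) q here      = inj₁ here
∈-++ᴾ (step e p) q (there h) = [ (λ h′ → inj₁ (there h′)) , inj₂ ] (∈-++ᴾ p q h)

last∈nodes : ∀ {n v m} (p : Path n v m) → m ∈ nodes p
last∈nodes (single _) = here
last∈nodes (step _ p) = there (last∈nodes p)

_▷_ : ∀ {n v m u} → Path n v m → Edge n m u → Path n v u
p ▷ e = p ++ᴾ step e (single (proj₁ (proj₂ e)))

∈-▷ : ∀ {n v m u w} (p : Path n v m) (e : Edge n m u) →
      w ∈ nodes (p ▷ e) → w ∈ nodes p ⊎ w ≡ u
∈-▷ p e h with ∈-++ᴾ p _ h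
... | inj₁ h′                = inj₁ h′
... | inj₂ here              = inj₁ (last∈nodes p)
... | inj₂ (there here)      = inj₂ refl
... | inj₂ (there (there ()))

line : ∀ {n} (pt : ℕ → Node) → (∀ i → Adjacent (pt i) (pt (suc i))) →
       ∀ {x a} → x ≤′ a → (∀ {i} → x ≤ i → i ≤ a → InV n (pt i)) →
       Path n (pt x) (pt a)
line pt adj (_≤′_.≤′-reflexive refl) inV = single (inV ≤-refl ≤-refl)
line pt adj {a = suc a} (_≤′_.≤′-step x≤a) inV =
  line pt adj x≤a (λ x≤i i≤a → inV x≤i (m≤n⇒m≤1+n i≤a))
    ▷ (inV (≤′⇒≤ x≤a) (n≤1+n a) , inV (m≤n⇒m≤1+n (≤′⇒≤ x≤a)) ≤-refl , adj a)

∈-line : ∀ {n w} (pt : ℕ → Node) (adj : ∀ i → Adjacent (pt i) (pt (suc i)))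
         {x a} (x≤a : x ≤′ a) (inV : ∀ {i} → x ≤ i → i ≤ a → InV n (pt i)) →
         w ∈ nodes (line pt adj x≤a inV) → Σ ℕ (λ i → w ≡ pt i)
∈-line pt adj (_≤′_.≤′-reflexive refl) inV here = _ , refl
∈-line pt adj {a = suc a} (_≤′_.≤′-step x≤a) inV h
  with ∈-▷ (line pt adj x≤a (λ x≤i i≤a → inV x≤i (m≤n⇒m≤1+n i≤a))) _ h
... | inj₁ h′   = ∈-line pt adj x≤a _ h′
... | inj₂ refl = suc a , refl

row : ∀ {n k x a} → 1 ≤ k → k ≤ n → 1 ≤ x → x ≤ a → a ≤ n → Path n (x , k) (a , k)
row {k = k} 1≤k k≤n 1≤x x≤a a≤n =
  line (λ i → i , k) (λ _ → inj₁ (refl , refl)) (≤⇒≤′ x≤a)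
       (λ x≤i i≤a → (≤-trans 1≤x x≤i , ≤-trans i≤a a≤n) , (1≤k , k≤n))

∈-row : ∀ {n k x a w} (1≤k : 1 ≤ k) (k≤n : k ≤ n) (1≤x : 1 ≤ x) (x≤a : x ≤ a) (a≤n : a ≤ n) →
        w ∈ nodes (row 1≤k k≤n 1≤x x≤a a≤n) → proj₂ w ≡ k
∈-row {k = k} 1≤k k≤n 1≤x x≤a a≤n h with ∈-line (λ i → i , k) _ (≤⇒≤′ x≤a) _ h
... | _ , refl = refl

column : ∀ {n a y b} → 1 ≤ a → a ≤ n → 1 ≤ y → y ≤ b → b ≤ n → Path n (a , y) (a , b)
column {a = a} 1≤a a≤n 1≤y y≤b b≤n =
  line (λ j → a , j) (λ _ → inj₂ (refl , refl)) (≤⇒≤′ y≤b)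
       (λ y≤j j≤b → (1≤a , a≤n) , (≤-trans 1≤y y≤j , ≤-trans j≤b b≤n))

∈-column : ∀ {n a y b w} (1≤a : 1 ≤ a) (a≤n : a ≤ n) (1≤y : 1 ≤ y) (y≤b : y ≤ b) (b≤n : b ≤ n) →
           w ∈ nodes (column 1≤a a≤n 1≤y y≤b b≤n) → proj₁ w ≡ a
∈-column {a = a} 1≤a a≤n 1≤y y≤b b≤n h with ∈-line (λ j → a , j) _ (≤⇒≤′ y≤b) _ h
... | _ , refl = refl

otherRow : ℕ → ℕ
otherRow (suc zero) = 2
otherRow _          = 1

otherRow-≢ : ∀ d → ¬ (otherRow d ≡ d)
otherRow-≢ zero          ()
otherRow-≢ (suc zero)    ()
otherRow-≢ (suc (suc d)) ()

otherRow-bounds : ∀ d → 1 ≤ otherRow d × otherRow d ≤ 2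
otherRow-bounds zero          = s≤s z≤n , s≤s z≤n
otherRow-bounds (suc zero)    = s≤s z≤n , ≤-refl
otherRow-bounds (suc (suc d)) = s≤s z≤n , s≤s z≤n

-- For n ≥ 3 the index n is neither 1 nor 2, so the run starts are not corners.
small≢n : ∀ {n k} → 3 ≤ n → k ≤ 2 → ¬ (k ≡ n)
small≢n 3≤n k≤2 refl with ≤-trans 3≤n k≤2
... | s≤s (s≤s ())

≢1⇒2≤ : ∀ {m} → 1 ≤ m → ¬ (m ≡ 1) → 2 ≤ m
≢1⇒2≤ 1≤m m≢1 = ≤∧≢⇒< 1≤m (λ e → m≢1 (sym e))

rowStart : ∀ {n k} → 3 ≤ n → 1 ≤ k → k ≤ 2 → InS n (1 , k)
rowStart 3≤n 1≤k k≤2 =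
  (((≤-refl , ≤-trans (s≤s z≤n) 3≤n) , (1≤k , ≤-trans k≤2 (≤-trans (n≤1+n 2) 3≤n))) , inj₁ refl) ,
  (λ e → small≢n 3≤n k≤2 (cong proj₂ e)) ,
  (λ e → small≢n 3≤n (s≤s z≤n) (cong proj₁ e))

columnStart : ∀ {n x} → 3 ≤ n → 1 ≤ x → x < n → InS n (x , 1)
columnStart 3≤n 1≤x x<n =
  (((1≤x , <⇒≤ x<n) , (≤-refl , ≤-trans (s≤s z≤n) 3≤n)) , inj₂ refl) ,
  (λ e → small≢n 3≤n (s≤s z≤n) (cong proj₂ e)) ,
  (λ e → <⇒≢ x<n (cong proj₁ e))

onBoundary : ∀ {n u w} → InV⁻ n u → (proj₁ u ≡ 1 ⊎ proj₂ u ≡ 1) → ¬ (w ≡ u) →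
             AvoidingPath n w u
onBoundary {u = u} (u∈V , u≢⌜1,n⌝ , u≢⌜n,1⌝) u∈𝔪 w≢u =
  u , ((u∈V , u∈𝔪) , u≢⌜1,n⌝ , u≢⌜n,1⌝) , single u∈V , λ { here → w≢u refl ; (there ()) }

sameColumn : ∀ {n a b w} → 3 ≤ n → 2 ≤ a → a ≤ n → 1 ≤ b → b ≤ n →
             proj₁ w ≡ a → ¬ (w ≡ (a , b)) → AvoidingPath n w (a , b)
sameColumn {n} {suc x} {b} 3≤n (s≤s 1≤x) a≤n 1≤b b≤n w₁≡a w≢u =
  (x , 1) , columnStart 3≤n 1≤x a≤n , path , avoids
  where
  x≤n : x ≤ n
  x≤n = ≤-trans (n≤1+n x) a≤n
  climb : Path n (x , 1) (x , b)
  climb = column 1≤x x≤n ≤-refl 1≤b b≤n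
  path : Path n (x , 1) (suc x , b)
  path = climb ▷ (((1≤x , x≤n) , (1≤b , b≤n)) , ((s≤s z≤n , a≤n) , (1≤b , b≤n)) , inj₁ (refl , refl))
  avoids : ¬ (_ ∈ nodes path)
  avoids h with ∈-▷ climb _ h
  ... | inj₁ h′  = <⇒≢ ≤-refl (trans (sym (∈-column 1≤x x≤n ≤-refl 1≤b b≤n h′)) w₁≡a)
  ... | inj₂ w≡u = w≢u w≡u

otherColumn : ∀ {n a b w} → 3 ≤ n → 1 ≤ a → a ≤ n → 2 ≤ b → b ≤ n →
              ¬ (proj₁ w ≡ a) → AvoidingPath n w (a , b)
otherColumn {n} {a} {b} {w} 3≤n 1≤a a≤n 2≤b b≤n w₁≢a =
  (1 , k) , rowStart 3≤n 1≤k k≤2 , walk ++ᴾ climb , avoids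
  where
  k : ℕ
  k = otherRow (proj₂ w)
  1≤k : 1 ≤ k
  1≤k = proj₁ (otherRow-bounds (proj₂ w))
  k≤2 : k ≤ 2
  k≤2 = proj₂ (otherRow-bounds (proj₂ w))
  k≤b : k ≤ b
  k≤b = ≤-trans k≤2 2≤b
  k≤n : k ≤ n
  k≤n = ≤-trans k≤b b≤n
  walk : Path n (1 , k) (a , k)
  walk = row 1≤k k≤n ≤-refl 1≤a a≤n
  climb : Path n (a , k) (a , b)
  climb = column 1≤a a≤n 1≤k k≤b b≤n
  avoids : ¬ (w ∈ nodes (walk ++ᴾ climb))
  avoids h with ∈-++ᴾ walk climb h
  ... | inj₁ h′ = otherRow-≢ (proj₂ w) (sym (∈-row 1≤k k≤n ≤-refl 1≤a a≤n h′))
  ... | inj₂ h′ = w₁≢a (∈-column 1≤a a≤n 1≤k k≤b b≤n h′)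

lemma4 : (n : ℕ) → 3 ≤ n → (u w : Node) → InV⁻ n u → InSof n u w → ¬ (w ≡ u) →
    Σ Node (λ s → InS n s × Σ (Path n s u) (λ p → ¬ (w ∈ nodes p)))
lemma4 n 3≤n (a , b) w u∈V⁻@(((1≤a , a≤n) , (1≤b , b≤n)) , _) _ w≢u with a ≟ 1 | b ≟ 1
... | yes a≡1 | _       = onBoundary u∈V⁻ (inj₁ a≡1) w≢u
... | no _    | yes b≡1 = onBoundary u∈V⁻ (inj₂ b≡1) w≢u
... | no a≢1  | no b≢1 with proj₁ w ≟ a
...   | yes w₁≡a = sameColumn 3≤n (≢1⇒2≤ 1≤a a≢1) a≤n 1≤b b≤n w₁≡a w≢u
...   | no w₁≢a  = otherColumn 3≤n 1≤a a≤n (≢1⇒2≤ 1≤b b≢1) b≤n w₁≢a
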